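{- Let $S=(p,q,r)\in\mathbb{R}_{>0}^3$ satisfy $C(S)\le 4$ and $p,q,r\ge2$. Then $S$ is cluster-positive.
   Context: For $(p,q,r)\in\mathbb{R}^3$: $\gamma_1(p,q,r)=(qr-p,q,r)$, $\gamma_2(p,q,r)=(p,rp-q,r)$, $\gamma_3(p,q,r)=(p,q,pq-r)$. $\Gamma(S)$ is the set of all $\gamma_{t_k}\cdots\gamma_{t_1}(S)$ with $k\ge0$, $t_i\in\{1,2,3\}$, $t_i\ne t_{i+1}$. $S\in\mathbb{R}^3_{>0}$ is cluster-positive if every element of $\Gamma(S)$ has all entries positive. Markov constant: $C(p,q,r)=p^2+q^2+r^2-pqr$. -}

module Defs where

open import Level using (0ℓ)
open import Data.Product using (Σ; ∃; _×_; _,_)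
open import Data.Sum using (_⊎_)
open import Data.Fin using (Fin; zero; suc)
open import Data.List using (List; []; _∷_)
open import Data.Unit using (⊤)
open import Relation.Binary.PropositionalEquality using (_≡_)
open import Relation.Nullary using (¬_)
open import Relation.Binary.Structures using (IsStrictTotalOrder)
open import Algebra.Structures using (IsCommutativeRing)

-- The real numbers, axiomatised as a Dedekind-complete ordered field
-- (any model of this record is isomorphic to ℝ).  Equality is ≡.
record RealField : Set₁ where
  infixl 6 _+_ _-_
  infixl 7 _*_
  infix 4 _<_ _≤_
  field
    ℝ   : Set
    _+_ _*_ : ℝ → ℝ → ℝ
    -_  : ℝ → ℝ
    0# 1# : ℝ
    _<_ : ℝ → ℝ → Set
    isCommutativeRing : IsCommutativeRing _≡_ _+_ _*_ -_ 0# 1#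
    inverse : ∀ x → ¬ (x ≡ 0#) → ∃ λ y → x * y ≡ 1#
    isStrictTotalOrder : IsStrictTotalOrder _≡_ _<_
    0<1 : 0# < 1#
    +-mono-< : ∀ {x y} z → x < y → x + z < y + z
    *-pos : ∀ {x y} → 0# < x → 0# < y → 0# < x * y

  _≤_ : ℝ → ℝ → Set
  x ≤ y = x < y ⊎ x ≡ y

  _-_ : ℝ → ℝ → ℝ
  x - y = x + (- y)

  field
    lub : (P : ℝ → Set) → ∃ P → (∃ λ b → ∀ x → P x → x ≤ b) →
          ∃ λ s → (∀ x → P x → x ≤ s) × (∀ b → (∀ x → P x → x ≤ b) → s ≤ b)

  2# 4# : ℝ
  2# = 1# + 1#
  4# = 2# + 2#

module Cluster (R : RealField) where
  open RealField R public

  Triple : Set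
  Triple = ℝ × ℝ × ℝ

  γ : Fin 3 → Triple → Triple
  γ zero          (p , q , r) = (q * r - p , q , r)
  γ (suc zero)    (p , q , r) = (p , r * p - q , r)
  γ (suc (suc zero)) (p , q , r) = (p , q , p * q - r)

  C : Triple → ℝ
  C (p , q , r) = p * p + q * q + r * r - p * q * r

  Positive : Triple → Set
  Positive (p , q , r) = (0# < p) × (0# < q) × (0# < r)

  Reduced : List (Fin 3) → Set
  Reduced []           = ⊤
  Reduced (t ∷ [])     = ⊤
  Reduced (t ∷ u ∷ ts) = ¬ (t ≡ u) × Reduced (u ∷ ts)

  -- apply γ_{t_k} ⋯ γ_{t_1} to S, for the word [t₁, …, t_k]
  apply : List (Fin 3) → Triple → Triple
  apply []       S = S
  apply (t ∷ ts) S = apply ts (γ t S)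

  ClusterPositive : Triple → Set
  ClusterPositive S = Positive S × (∀ ts → Reduced ts → Positive (apply ts S))

-- The region {C ≤ 4, p, q, r ≥ 2} is closed under every γₜ,
-- and its points are positive.  The mutations preserve C (the two values
-- of the mutated entry are the roots of a monic quadratic).  For the new
-- entry bc − a, put x = a − 2 and y = bc − a − 2: then x ≥ 0,
-- x + y = (b − 2)(c − 2) + 2(b − 2) + 2(c − 2) ≥ 0 and
-- x y = (b − c)² + 4 − C(a, b, c) ≥ 0, which together force y ≥ 0.

module Submission where

open import Algebra.Bundles using (CommutativeRing)
open import Algebra.Solver.Ring.AlmostCommutativeRing
  using (_-Raw-AlmostCommutative⟶_; fromCommutativeRing)
open import Data.Integer.Base as ℤ using (ℤ; +_; -[1+_]; +[1+_])
import Data.Integer.Properties as ℤ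
open import Data.List.Base using ([]; _∷_)
open import Data.Maybe.Base as Maybe using (Maybe)
open import Data.Nat.Base as ℕ using (zero; suc)
import Data.Nat.Properties as ℕ
open import Data.Product.Base using (_,_)
open import Data.Sum.Base using (inj₁; inj₂)
open import Relation.Binary.Consequences using (dec⇒weaklyDec)
open import Relation.Binary.Definitions using (tri<; tri≈; tri>)
open import Relation.Binary.PropositionalEquality.Core as ≡ using (_≡_)
open import Relation.Binary.Structures using (IsStrictTotalOrder)
open import Relation.Nullary.Negation using (contradiction)

open import Defs

-- ℤ maps into every commutative ring, so the ring solver can use integer
-- coefficients there (with the abstract carrier as coefficient ring, the
-- solver's normal forms could not be compared).

module IntegerCoefficients {c ℓ} (R : CommutativeRing c ℓ) where
  open CommutativeRing R
  open import Algebra.Properties.Ring ring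
    using (-0#≈0#; -‿involutive; -‿+-comm; -‿distribˡ-*)
  open import Algebra.Properties.Semiring.Mult.TCOptimised semiring
    using (_×_; 1+×; ×-homo-+)
  open import Algebra.Properties.CommutativeSemigroup +-commutativeSemigroup
    using (interchange)
  open import Relation.Binary.Reasoning.Setoid setoid

  ⟦_⟧ℤ : ℤ → Carrier
  ⟦ + n ⟧ℤ = n × 1#
  ⟦ -[1+ n ] ⟧ℤ = - (suc n × 1#)

  private
    ⟦⟧-cong : ∀ {i j} → i ≡ j → ⟦ i ⟧ℤ ≈ ⟦ j ⟧ℤ
    ⟦⟧-cong ≡.refl = refl

    -‿cancel-+ˡ : ∀ x y z → (x + y) - (x + z) ≈ y - z
    -‿cancel-+ˡ x y z = begin
      (x + y) - (x + z)       ≈⟨ +-congˡ (-‿+-comm x z) ⟨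
      (x + y) + (- x + - z)   ≈⟨ interchange x y (- x) (- z) ⟩
      (x - x) + (y - z)       ≈⟨ +-congʳ (-‿inverseʳ x) ⟩
      0# + (y - z)            ≈⟨ +-identityˡ (y - z) ⟩
      y - z                   ∎

  ⟦⟧-homo-⊖ : ∀ m n → ⟦ m ℤ.⊖ n ⟧ℤ ≈ m × 1# - n × 1#
  ⟦⟧-homo-⊖ m zero = begin
    ⟦ m ℤ.⊖ 0 ⟧ℤ   ≈⟨ ⟦⟧-cong (ℤ.≤-⊖ (ℕ.z≤n {m})) ⟩
    m × 1#         ≈⟨ +-identityʳ (m × 1#) ⟨
    m × 1# + 0#    ≈⟨ +-congˡ -0#≈0# ⟨
    m × 1# - 0#    ∎
  ⟦⟧-homo-⊖ zero (suc n) = sym (+-identityˡ _)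
  ⟦⟧-homo-⊖ (suc m) (suc n) = begin
    ⟦ suc m ℤ.⊖ suc n ⟧ℤ            ≈⟨ ⟦⟧-cong (ℤ.[1+m]⊖[1+n]≡m⊖n m n) ⟩
    ⟦ m ℤ.⊖ n ⟧ℤ                    ≈⟨ ⟦⟧-homo-⊖ m n ⟩
    m × 1# - n × 1#                 ≈⟨ -‿cancel-+ˡ 1# (m × 1#) (n × 1#) ⟨
    (1# + m × 1#) - (1# + n × 1#)   ≈⟨ +-cong (1+× m 1#) (-‿cong (1+× n 1#)) ⟨
    suc m × 1# - suc n × 1#         ∎

  ⟦⟧-homo-neg : ∀ i → ⟦ ℤ.- i ⟧ℤ ≈ - ⟦ i ⟧ℤ
  ⟦⟧-homo-neg (+ zero)   = sym -0#≈0#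
  ⟦⟧-homo-neg +[1+ n ]   = refl
  ⟦⟧-homo-neg -[1+ n ]   = sym (-‿involutive _)

  ⟦⟧-homo-+ : ∀ i j → ⟦ i ℤ.+ j ⟧ℤ ≈ ⟦ i ⟧ℤ + ⟦ j ⟧ℤ
  ⟦⟧-homo-+ -[1+ m ] -[1+ n ] = begin
    ⟦ -[1+ suc (m ℕ.+ n) ] ⟧ℤ         ≈⟨ ⟦⟧-cong (≡.cong -[1+_] (ℕ.+-suc m n)) ⟨
    - ((suc m ℕ.+ suc n) × 1#)        ≈⟨ -‿cong (×-homo-+ 1# (suc m) (suc n)) ⟩
    - (suc m × 1# + suc n × 1#)       ≈⟨ -‿+-comm (suc m × 1#) (suc n × 1#) ⟨
    - (suc m × 1#) + - (suc n × 1#)   ∎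
  ⟦⟧-homo-+ -[1+ m ] (+ n)    = trans (⟦⟧-homo-⊖ n (suc m)) (+-comm _ _)
  ⟦⟧-homo-+ (+ m)    -[1+ n ] = ⟦⟧-homo-⊖ m (suc n)
  ⟦⟧-homo-+ (+ m)    (+ n)    = ×-homo-+ 1# m n

  ⟦⟧-homo-*-+ : ∀ n j → ⟦ + n ℤ.* j ⟧ℤ ≈ n × 1# * ⟦ j ⟧ℤ
  ⟦⟧-homo-*-+ zero    j = sym (zeroˡ ⟦ j ⟧ℤ)
  ⟦⟧-homo-*-+ (suc n) j = begin
    ⟦ +[1+ n ] ℤ.* j ⟧ℤ                 ≈⟨ ⟦⟧-cong (ℤ.*-distribʳ-+ j (+ 1) (+ n)) ⟩
    ⟦ + 1 ℤ.* j ℤ.+ + n ℤ.* j ⟧ℤ        ≈⟨ ⟦⟧-cong (≡.cong (ℤ._+ + n ℤ.* j) (ℤ.*-identityˡ j)) ⟩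
    ⟦ j ℤ.+ + n ℤ.* j ⟧ℤ                ≈⟨ ⟦⟧-homo-+ j (+ n ℤ.* j) ⟩
    ⟦ j ⟧ℤ + ⟦ + n ℤ.* j ⟧ℤ             ≈⟨ +-congˡ (⟦⟧-homo-*-+ n j) ⟩
    ⟦ j ⟧ℤ + n × 1# * ⟦ j ⟧ℤ            ≈⟨ +-congʳ (*-identityˡ ⟦ j ⟧ℤ) ⟨
    1# * ⟦ j ⟧ℤ + n × 1# * ⟦ j ⟧ℤ       ≈⟨ distribʳ ⟦ j ⟧ℤ 1# (n × 1#) ⟨
    (1# + n × 1#) * ⟦ j ⟧ℤ              ≈⟨ *-congʳ (1+× n 1#) ⟨
    suc n × 1# * ⟦ j ⟧ℤ                 ∎

  ⟦⟧-homo-* : ∀ i j → ⟦ i ℤ.* j ⟧ℤ ≈ ⟦ i ⟧ℤ * ⟦ j ⟧ℤ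
  ⟦⟧-homo-* (+ n)    j = ⟦⟧-homo-*-+ n j
  ⟦⟧-homo-* -[1+ n ] j = begin
    ⟦ -[1+ n ] ℤ.* j ⟧ℤ          ≈⟨ ⟦⟧-cong (ℤ.neg-distribˡ-* +[1+ n ] j) ⟨
    ⟦ ℤ.- (+[1+ n ] ℤ.* j) ⟧ℤ    ≈⟨ ⟦⟧-homo-neg (+[1+ n ] ℤ.* j) ⟩
    - ⟦ +[1+ n ] ℤ.* j ⟧ℤ        ≈⟨ -‿cong (⟦⟧-homo-*-+ (suc n) j) ⟩
    - (suc n × 1# * ⟦ j ⟧ℤ)      ≈⟨ -‿distribˡ-* (suc n × 1#) ⟦ j ⟧ℤ ⟩
    - (suc n × 1#) * ⟦ j ⟧ℤ      ∎

  homomorphism : ℤ.+-*-rawRing -Raw-AlmostCommutative⟶ fromCommutativeRing R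
  homomorphism = record
    { ⟦_⟧    = ⟦_⟧ℤ
    ; +-homo = ⟦⟧-homo-+
    ; *-homo = ⟦⟧-homo-*
    ; -‿homo = ⟦⟧-homo-neg
    ; 0-homo = refl
    ; 1-homo = refl
    }

  coefficient≟ : ∀ i j → Maybe (⟦ i ⟧ℤ ≈ ⟦ j ⟧ℤ)
  coefficient≟ i j = Maybe.map ⟦⟧-cong (dec⇒weaklyDec ℤ._≟_ i j)

  open import Algebra.Solver.Ring
    ℤ.+-*-rawRing (fromCommutativeRing R) homomorphism coefficient≟ public

module OrderedField (R : RealField) where
  open RealField R
  open import Relation.Binary.PropositionalEquality using (refl; sym; subst; subst₂)
  open IsStrictTotalOrder isStrictTotalOrder
    using (compare; irrefl) renaming (trans to <-trans)

  commutativeRing : CommutativeRing _ _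
  commutativeRing = record { isCommutativeRing = isCommutativeRing }

  open CommutativeRing commutativeRing
    using (+-comm; +-identityˡ; +-identityʳ; zeroˡ; zeroʳ; -‿inverseʳ)
  open IntegerCoefficients commutativeRing
    using (solve; _:=_; _:+_; _:-_; _:*_; :-_; con)

  +-monoˡ-≤ : ∀ {x y} z → x ≤ y → x + z ≤ y + z
  +-monoˡ-≤ z (inj₁ x<y)  = inj₁ (+-mono-< z x<y)
  +-monoˡ-≤ z (inj₂ refl) = inj₂ refl

  x≤y⇒0≤y-x : ∀ {x y} → x ≤ y → 0# ≤ y - x
  x≤y⇒0≤y-x {x} {y} x≤y = subst (_≤ y - x) (-‿inverseʳ x) (+-monoˡ-≤ (- x) x≤y)

  0≤y-x⇒x≤y : ∀ {x y} → 0# ≤ y - x → x ≤ y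
  0≤y-x⇒x≤y {x} {y} 0≤y-x =
    subst₂ _≤_ (+-identityˡ x) (solve 2 (λ x y → (y :- x) :+ x := y) refl x y)
      (+-monoˡ-≤ x 0≤y-x)

  0≤x⇒0<y⇒0<x+y : ∀ {x y} → 0# ≤ x → 0# < y → 0# < x + y
  0≤x⇒0<y⇒0<x+y {y = y} (inj₂ refl) 0<y = subst (0# <_) (sym (+-identityˡ y)) 0<y
  0≤x⇒0<y⇒0<x+y {x} {y} (inj₁ 0<x) 0<y =
    <-trans 0<x (subst₂ _<_ (+-identityˡ x) (+-comm y x) (+-mono-< x 0<y))

  +-nonneg : ∀ {x y} → 0# ≤ x → 0# ≤ y → 0# ≤ x + y
  +-nonneg {x} 0≤x (inj₁ 0<y) = inj₁ (0≤x⇒0<y⇒0<x+y 0≤x 0<y)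
  +-nonneg {x} 0≤x (inj₂ refl) = subst (0# ≤_) (sym (+-identityʳ x)) 0≤x

  *-nonneg : ∀ {x y} → 0# ≤ x → 0# ≤ y → 0# ≤ x * y
  *-nonneg (inj₁ 0<x) (inj₁ 0<y) = inj₁ (*-pos 0<x 0<y)
  *-nonneg {y = y} (inj₂ refl) _ = inj₂ (sym (zeroˡ y))
  *-nonneg {x = x} _ (inj₂ refl) = inj₂ (sym (zeroʳ x))

  neg-pos : ∀ {x} → x < 0# → 0# < - x
  neg-pos {x} x<0 = subst₂ _<_ (-‿inverseʳ x) (+-identityˡ (- x)) (+-mono-< (- x) x<0)

  square-nonneg : ∀ x → 0# ≤ x * x
  square-nonneg x with compare 0# x
  ... | tri< 0<x _ _ = inj₁ (*-pos 0<x 0<x)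
  ... | tri≈ _ refl _ = inj₂ (sym (zeroˡ 0#))
  ... | tri> _ _ x<0 =
    inj₁ (subst (0# <_) (solve 1 (λ x → (:- x) :* (:- x) := x :* x) refl x)
                (*-pos (neg-pos x<0) (neg-pos x<0)))

  nonneg-sum-product⇒nonneg : ∀ {x y} → 0# ≤ x → 0# ≤ x + y → 0# ≤ x * y → 0# ≤ y
  nonneg-sum-product⇒nonneg {x} {y} 0≤x 0≤x+y 0≤xy with compare 0# y
  ... | tri< 0<y _ _ = inj₁ 0<y
  ... | tri≈ _ 0≡y _ = inj₂ 0≡y
  ... | tri> _ _ y<0 = contradiction 0<0 (irrefl refl)
    where
    0<x : 0# < x
    0<x = subst (0# <_) (solve 2 (λ x y → (x :+ y) :+ (:- y) := x) refl x y)
                (0≤x⇒0<y⇒0<x+y 0≤x+y (neg-pos y<0))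
    0<0 : 0# < 0#
    0<0 = subst (0# <_) (solve 2 (λ x y → x :* y :+ x :* (:- y) := con (+ 0)) refl x y)
                (0≤x⇒0<y⇒0<x+y 0≤xy (*-pos 0<x (neg-pos y<0)))

  0<2 : 0# < 2#
  0<2 = <-trans 0<1 (subst (_< 2#) (+-identityˡ 1#) (+-mono-< 1# 0<1))

  2≤x⇒0<x : ∀ {x} → 2# ≤ x → 0# < x
  2≤x⇒0<x (inj₁ 2<x)  = <-trans 0<2 2<x
  2≤x⇒0<x (inj₂ refl) = 0<2

module Markov (R : RealField) where
  open Cluster R
  open OrderedField R
  open IntegerCoefficients commutativeRing
    using (Polynomial; solve; _:=_; _:+_; _:-_; _:*_; con)
  open import Data.Fin.Base using (zero; suc)
  open import Data.Product.Base using (_×_)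
  open import Relation.Binary.PropositionalEquality using (refl; sym; subst)

  -- ⟦ con (+ 2) ⟧ evaluates to 1# + 1#, which is 2# by definition; 4# is
  -- written two :+ two, since 4 × 1# is not definitionally 4#.
  two : ∀ {n} → Polynomial n
  two = con (+ 2)

  C-γ : ∀ t S → C (γ t S) ≡ C S
  C-γ zero (p , q , r) = solve 3 (λ p q r →
    (q :* r :- p) :* (q :* r :- p) :+ q :* q :+ r :* r :- (q :* r :- p) :* q :* r
      := p :* p :+ q :* q :+ r :* r :- p :* q :* r) refl p q r
  C-γ (suc zero) (p , q , r) = solve 3 (λ p q r →
    p :* p :+ (r :* p :- q) :* (r :* p :- q) :+ r :* r :- p :* (r :* p :- q) :* r
      := p :* p :+ q :* q :+ r :* r :- p :* q :* r) refl p q r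
  C-γ (suc (suc zero)) (p , q , r) = solve 3 (λ p q r →
    p :* p :+ q :* q :+ (p :* q :- r) :* (p :* q :- r) :- p :* q :* (p :* q :- r)
      := p :* p :+ q :* q :+ r :* r :- p :* q :* r) refl p q r

  C-rotate : ∀ p q r → C (q , r , p) ≡ C (p , q , r)
  C-rotate = solve 3 (λ p q r →
    q :* q :+ r :* r :+ p :* p :- q :* r :* p
      := p :* p :+ q :* q :+ r :* r :- p :* q :* r) refl

  2≤mutation : ∀ {a b c} → 2# ≤ a → 2# ≤ b → 2# ≤ c → C (a , b , c) ≤ 4# →
               2# ≤ b * c - a
  2≤mutation {a} {b} {c} 2≤a 2≤b 2≤c C≤4 =
    0≤y-x⇒x≤y (nonneg-sum-product⇒nonneg (x≤y⇒0≤y-x 2≤a) 0≤sum 0≤product)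
    where
    0≤2 = inj₁ 0<2
    0≤b-2 = x≤y⇒0≤y-x 2≤b
    0≤c-2 = x≤y⇒0≤y-x 2≤c
    0≤sum : 0# ≤ (a - 2#) + (b * c - a - 2#)
    0≤sum = subst (0# ≤_)
      (solve 3 (λ a b c →
         (b :- two) :* (c :- two) :+ two :* (b :- two) :+ two :* (c :- two)
           := (a :- two) :+ (b :* c :- a :- two)) refl a b c)
      (+-nonneg (+-nonneg (*-nonneg 0≤b-2 0≤c-2) (*-nonneg 0≤2 0≤b-2))
                (*-nonneg 0≤2 0≤c-2))
    0≤product : 0# ≤ (a - 2#) * (b * c - a - 2#)
    0≤product = subst (0# ≤_)
      (solve 3 (λ a b c →
         (b :- c) :* (b :- c) :+ (two :+ two :- (a :* a :+ b :* b :+ c :* c :- a :* b :* c))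
           := (a :- two) :* (b :* c :- a :- two)) refl a b c)
      (+-nonneg (square-nonneg (b - c)) (x≤y⇒0≤y-x C≤4))

  AtLeastTwo : Triple → Set
  AtLeastTwo (p , q , r) = (2# ≤ p) × (2# ≤ q) × (2# ≤ r)

  AtLeastTwo⇒Positive : ∀ S → AtLeastTwo S → Positive S
  AtLeastTwo⇒Positive _ (2≤p , 2≤q , 2≤r) = 2≤x⇒0<x 2≤p , 2≤x⇒0<x 2≤q , 2≤x⇒0<x 2≤r

  γ-preserves-AtLeastTwo : ∀ t S → C S ≤ 4# → AtLeastTwo S → AtLeastTwo (γ t S)
  γ-preserves-AtLeastTwo zero (p , q , r) C≤4 (2≤p , 2≤q , 2≤r) =
    2≤mutation 2≤p 2≤q 2≤r C≤4 , 2≤q , 2≤r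
  γ-preserves-AtLeastTwo (suc zero) (p , q , r) C≤4 (2≤p , 2≤q , 2≤r) =
    2≤p , 2≤mutation 2≤q 2≤r 2≤p (subst (_≤ 4#) (sym (C-rotate p q r)) C≤4) , 2≤r
  γ-preserves-AtLeastTwo (suc (suc zero)) (p , q , r) C≤4 (2≤p , 2≤q , 2≤r) =
    2≤p , 2≤q , 2≤mutation 2≤r 2≤p 2≤q (subst (_≤ 4#) (C-rotate r p q) C≤4)

  apply-preserves-AtLeastTwo : ∀ ts S → C S ≤ 4# → AtLeastTwo S →
                               AtLeastTwo (apply ts S)
  apply-preserves-AtLeastTwo []       S C≤4 2≤S = 2≤S
  apply-preserves-AtLeastTwo (t ∷ ts) S C≤4 2≤S =
    apply-preserves-AtLeastTwo ts (γ t S) (subst (_≤ 4#) (sym (C-γ t S)) C≤4)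
      (γ-preserves-AtLeastTwo t S C≤4 2≤S)

lemma4p7 : (R : RealField) → let open Cluster R in
    (p q r : ℝ) → 0# < p → 0# < q → 0# < r →
    C (p , q , r) ≤ 4# → 2# ≤ p → 2# ≤ q → 2# ≤ r →
    ClusterPositive (p , q , r)
lemma4p7 R p q r 0<p 0<q 0<r C≤4 2≤p 2≤q 2≤r =
  -- The invariant survives every γₜ.
  (0<p , 0<q , 0<r) , λ ts _ →
    AtLeastTwo⇒Positive _ (apply-preserves-AtLeastTwo ts (p , q , r) C≤4 (2≤p , 2≤q , 2≤r))
  where open Markov R
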